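{- Let $P=(r,E)$ be a compact polymatroid. Then $P/A$ is compact for every $A\subseteq E$.
   Context: A polymatroid $P=(r,E)$ is a finite set $E$ with a function $r:2^E\to\mathbb{R}$ that is normalised, submodular and increasing. Its connectivity function is $\lambda_P(X)=r(X)+r(E-X)-r(E)$. An element $e$ is compact if $r(\{e\})=\lambda_P(\{e\})$, and $P$ is compact if all its elements are compact. For $A\subseteq E$, the contraction $P/A$ is the polymatroid on $E-A$ with rank function $r_{P/A}(X)=r(X\cup A)-r(A)$ for $X\subseteq E-A$. -}

module Defs where

open import Level using (Level; _⊔_; suc)
open import Data.Nat using (ℕ)
open import Data.Fin using (Fin)
open import Data.Fin.Subset using (Subset; ⊥; ⁅_⁆; _∈_; _⊆_; _∪_; _∩_; _─_)
open import Algebra.Bundles using (AbelianGroup)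
open import Relation.Binary.Core using (Rel)
open import Relation.Binary.Structures using (IsTotalOrder)

-- The codomain of a rank function.  The paper uses ℝ; we allow any totally
-- ordered abelian group (ℝ under + with its usual order is an instance).
record OrderedAbelianGroup (c ℓ₁ ℓ₂ : Level) : Set (suc (c ⊔ ℓ₁ ⊔ ℓ₂)) where
  field
    abelianGroup : AbelianGroup c ℓ₁
  open AbelianGroup abelianGroup public
  field
    _≤_         : Rel Carrier ℓ₂
    isTotalOrder : IsTotalOrder _≈_ _≤_
    ∙-monoˡ-≤   : ∀ {x y} z → x ≤ y → (z ∙ x) ≤ (z ∙ y)

module _ {c ℓ₁ ℓ₂ : Level} (G : OrderedAbelianGroup c ℓ₁ ℓ₂) {n : ℕ} where
  open OrderedAbelianGroup G

  record IsPolymatroid (S : Subset n) (r : Subset n → Carrier) : Set (ℓ₁ ⊔ ℓ₂) where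
    field
      normalised : r ⊥ ≈ ε
      increasing : ∀ X Y → X ⊆ Y → Y ⊆ S → r X ≤ r Y
      submodular : ∀ X Y → X ⊆ S → Y ⊆ S → (r (X ∪ Y) ∙ r (X ∩ Y)) ≤ (r X ∙ r Y)

  connectivity : (S : Subset n) (r : Subset n → Carrier) → Subset n → Carrier
  connectivity S r X = (r X ∙ r (S ─ X)) - r S

  IsCompactElement : (S : Subset n) (r : Subset n → Carrier) → Fin n → Set ℓ₁
  IsCompactElement S r e = r ⁅ e ⁆ ≈ connectivity S r ⁅ e ⁆

  IsCompact : (S : Subset n) (r : Subset n → Carrier) → Set ℓ₁
  IsCompact S r = ∀ e → e ∈ S → IsCompactElement S r e

  contractGround : Subset n → Subset n → Subset n
  contractGround S A = S ─ A

  contractRank : (r : Subset n → Carrier) → Subset n → Subset n → Carrier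
  contractRank r A X = r (X ∪ A) - r A

-- An element e is compact exactly when deleting it does not lower the rank:
-- r(E - e) = r(E).  In P/A the same condition reads r((E - A - e) ∪ A) = r(E),
-- and (E - A - e) ∪ A = (E - e) ∪ A lies between E - e and E, so monotonicity
-- squeezes its rank to r(E).

module Submission where

open import Defs
open import Level using (Level)
open import Data.Nat using (ℕ)
open import Data.Bool using (true; false)
open import Data.Vec using ([]; _∷_)
open import Data.Fin.Subset using (Subset; ⊤; ⁅_⁆; _⊆_; _∪_; _─_)
open import Data.Fin.Subset.Properties
  using (∈⊤; ⊆⊤; ⊆-refl; ⊆-trans; ⊆-antisym; p⊆p∪q; x∈p∪q⁻; p─q⊆p; p─q─r≡p─r─q)
open import Data.Sum using ([_,_])
open import Function using (_∘_)
open import Function.Bundles using (_⇔_; mk⇔; Equivalence)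
open import Relation.Binary.Structures using (IsTotalOrder)
open import Relation.Binary.PropositionalEquality using (_≡_; refl; cong)
import Algebra.Properties.Group as GroupProperties
import Relation.Binary.Reasoning.Setoid as SetoidReasoning

p─q∪q≡p∪q : ∀ {n} (p q : Subset n) → (p ─ q) ∪ q ≡ p ∪ q
p─q∪q≡p∪q []          []          = refl
p─q∪q≡p∪q (true  ∷ p) (true  ∷ q) = cong (true ∷_) (p─q∪q≡p∪q p q)
p─q∪q≡p∪q (false ∷ p) (true  ∷ q) = cong (true ∷_) (p─q∪q≡p∪q p q)
p─q∪q≡p∪q (true  ∷ p) (false ∷ q) = cong (true ∷_) (p─q∪q≡p∪q p q)
p─q∪q≡p∪q (false ∷ p) (false ∷ q) = cong (false ∷_) (p─q∪q≡p∪q p q)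

module _ {n : ℕ} where

  ∪-least : {p q s : Subset n} → p ⊆ s → q ⊆ s → p ∪ q ⊆ s
  ∪-least {p} {q} p⊆s q⊆s = [ p⊆s , q⊆s ] ∘ x∈p∪q⁻ p q

  q⊆p⇒p∪q≡p : {p q : Subset n} → q ⊆ p → p ∪ q ≡ p
  q⊆p⇒p∪q≡p {q = q} q⊆p = ⊆-antisym (∪-least ⊆-refl q⊆p) (p⊆p∪q q)

module _ {c ℓ₁ ℓ₂ : Level} (G : OrderedAbelianGroup c ℓ₁ ℓ₂) where
  open OrderedAbelianGroup G
  open GroupProperties group using (∙-cancelˡ; x∙y⁻¹≈ε⇒x≈y; x≈y⇒x∙y⁻¹≈ε)
  open IsTotalOrder isTotalOrder using (antisym; ≤-respˡ-≈)
  open SetoidReasoning setoid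

  x≈x∙y-z⇔y≈z : ∀ x y z → (x ≈ (x ∙ y) - z) ⇔ (y ≈ z)
  x≈x∙y-z⇔y≈z x y z = mk⇔ to from
    where
    to : x ≈ (x ∙ y) - z → y ≈ z
    to x≈x∙y-z = x∙y⁻¹≈ε⇒x≈y y z (∙-cancelˡ x _ _ (begin
      x ∙ (y - z) ≈⟨ assoc x y (z ⁻¹) ⟨
      (x ∙ y) - z ≈⟨ x≈x∙y-z ⟨
      x           ≈⟨ identityʳ x ⟨
      x ∙ ε       ∎))

    from : y ≈ z → x ≈ (x ∙ y) - z
    from y≈z = sym (begin
      (x ∙ y) - z ≈⟨ assoc x y (z ⁻¹) ⟩
      x ∙ (y - z) ≈⟨ ∙-congˡ (x≈y⇒x∙y⁻¹≈ε y≈z) ⟩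
      x ∙ ε       ≈⟨ identityʳ x ⟩
      x           ∎)

  module _ {n : ℕ} where

    isCompactElement⇔ : ∀ (S : Subset n) (r : Subset n → Carrier) e →
                        IsCompactElement G S r e ⇔ (r (S ─ ⁅ e ⁆) ≈ r S)
    isCompactElement⇔ S r e = x≈x∙y-z⇔y≈z (r ⁅ e ⁆) (r (S ─ ⁅ e ⁆)) (r S)

    module _ {S : Subset n} {r : Subset n → Carrier} (P : IsPolymatroid G S r) where
      open IsPolymatroid P

      rank-squeeze : ∀ {X Y Z} → X ⊆ Y → Y ⊆ Z → Z ⊆ S → r X ≈ r Z → r Y ≈ r Z
      rank-squeeze {X} {Y} {Z} X⊆Y Y⊆Z Z⊆S rX≈rZ = antisym
        (increasing Y Z Y⊆Z Z⊆S)
        (≤-respˡ-≈ rX≈rZ (increasing X Y X⊆Y (⊆-trans Y⊆Z Z⊆S)))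

      contraction-preserves-compactElement :
        ∀ {A e} → A ⊆ S → IsCompactElement G S r e →
        IsCompactElement G (contractGround G S A) (contractRank G r A) e
      contraction-preserves-compactElement {A} {e} A⊆S compact =
        Equivalence.from (isCompactElement⇔ (S ─ A) (contractRank G r A) e)
          (∙-congʳ (begin
            r ((S ─ A ─ ⁅ e ⁆) ∪ A) ≡⟨ cong (r ∘ (_∪ A)) (p─q─r≡p─r─q S A ⁅ e ⁆) ⟩
            r ((S ─ ⁅ e ⁆ ─ A) ∪ A) ≡⟨ cong r (p─q∪q≡p∪q (S ─ ⁅ e ⁆) A) ⟩
            r ((S ─ ⁅ e ⁆) ∪ A)     ≈⟨ rank-squeeze (p⊆p∪q A) (∪-least (p─q⊆p S ⁅ e ⁆) A⊆S) ⊆-refl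
                                         (Equivalence.to (isCompactElement⇔ S r e) compact) ⟩
            r S                     ≡⟨ cong r (q⊆p⇒p∪q≡p A⊆S) ⟨
            r (S ∪ A)               ≡⟨ cong r (p─q∪q≡p∪q S A) ⟨
            r ((S ─ A) ∪ A)         ∎))

lemma3p6 : ∀ {c ℓ₁ ℓ₂ : Level} (G : OrderedAbelianGroup c ℓ₁ ℓ₂) (n : ℕ)
             (r : Subset n → OrderedAbelianGroup.Carrier G) →
             IsPolymatroid G ⊤ r → IsCompact G ⊤ r →
             (A : Subset n) → IsCompact G (contractGround G ⊤ A) (contractRank G r A)
lemma3p6 G n r P compact A e _ =
  contraction-preserves-compactElement G P ⊆⊤ (compact e ∈⊤)
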